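{- Let $m \geq 3$ be an integer, let $\mathcal{A}$ be a finite set with a strict linear order $<$, and let $\mathcal{B}$ be a weakly $(m-1)$-wise balanced design over $\mathcal{A}$. Then $\alpha(\Gamma_{\mathcal{B}, m}) \leq |\mathcal{A}| + |\mathcal{B}|$, where $\alpha$ denotes the independence number.
   Context: For an integer $r \geq 2$ and a set $\mathcal{A}$ (whose elements are called points), a weakly $r$-wise balanced design over $\mathcal{A}$ is a family $\mathcal{B}$ of subsets of $\mathcal{A}$ (called blocks) such that: (1) any $r$ pairwise distinct points are contained together in at most one block; (2) every point lies in at least one block; (3) every block is non-empty. Given $m \geq 3$, a weakly $(m-1)$-wise balanced design $\mathcal{B}$ over $\mathcal{A}$, and a strict linear order $<$ on $\mathcal{A}$, the graph $\Gamma_{\mathcal{B}, m}$ has as vertices all incidence pairs $(x, B)$ with $B \in \mathcal{B}$ and $x \in B$; two vertices $(x, B_1)$ and $(y, B_2)$ are adjacent iff $x < y$, $B_1 \neq B_2$, and $x \in B_2$. -}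

module Defs where

open import Data.Nat using (ℕ)
open import Data.Fin using (Fin)
open import Data.Fin.Subset using (Subset; _∈_; Nonempty)
open import Data.Product using (_×_; _,_; Σ; ∃)
open import Data.List using (List)
open import Data.Sum using (_⊎_)
open import Data.List.Relation.Unary.Unique.Propositional using (Unique)
open import Data.List.Membership.Propositional renaming (_∈_ to _∈ˡ_)
open import Relation.Binary.PropositionalEquality using (_≡_; _≢_)
open import Relation.Nullary using (¬_)
open import Function.Definitions using (Injective)

-- Points are Fin n (an arbitrary finite set, up to bijection); a family of
-- b blocks is an injective map Fin b → Subset n (injective = a *set* of blocks).

record WeaklyBalanced (r n b : ℕ) (B : Fin b → Subset n) : Set where
  field
    atMostOne : (f : Fin r → Fin n) → Injective _≡_ _≡_ f →
                (i j : Fin b) →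
                (∀ k → f k ∈ B i) → (∀ k → f k ∈ B j) → i ≡ j
    covers : (x : Fin n) → ∃ λ i → x ∈ B i
    nonEmpty : (i : Fin b) → Nonempty (B i)

IsVertex : {n b : ℕ} → (B : Fin b → Subset n) → Fin n × Fin b → Set
IsVertex B (x , i) = x ∈ B i

AdjDir : {n b : ℕ} → (Fin n → Fin n → Set) → (B : Fin b → Subset n) →
         Fin n × Fin b → Fin n × Fin b → Set
AdjDir _<_ B (x , i) (y , j) = (x < y) × (i ≢ j) × (x ∈ B j)

Adj : {n b : ℕ} → (Fin n → Fin n → Set) → (B : Fin b → Subset n) →
      Fin n × Fin b → Fin n × Fin b → Set
Adj _<_ B u v = AdjDir _<_ B u v ⊎ AdjDir _<_ B v u

record IsIndependent {n b : ℕ} (_<_ : Fin n → Fin n → Set)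
       (B : Fin b → Subset n) (S : List (Fin n × Fin b)) : Set where
  field
    unique    : Unique S
    vertices  : ∀ {u} → u ∈ˡ S → IsVertex B u
    noEdges   : ∀ {u v} → u ∈ˡ S → v ∈ˡ S → ¬ Adj _<_ B u v

{-# OPTIONS --safe #-}
module Submission where

open import Defs
open import Data.Nat using (ℕ; _≤_; _+_; _∸_)
open import Data.Fin using (Fin; zero; suc; _≟_; join; splitAt)
open import Data.Fin.Properties using (splitAt-join; injective⇒≤)
open import Data.Fin.Subset using (Subset)
open import Data.Product using (_×_; _,_)
open import Data.Sum using (_⊎_; inj₁; inj₂)
open import Data.List using (List; length; lookup; _∷_)
open import Data.List.Relation.Unary.All as All using ()
open import Data.List.Relation.Unary.Any using (Any; any?)
open import Data.List.Relation.Unary.AllPairs using (_∷_)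
open import Data.List.Relation.Unary.Unique.Propositional using (Unique)
open import Data.List.Membership.Propositional using (_∈_; lose; find)
open import Data.List.Membership.Propositional.Properties using (∈-lookup)
open import Relation.Binary.PropositionalEquality using (_≡_; refl; sym; cong; module ≡-Reasoning)
open import Relation.Binary.Definitions using (Trichotomous; tri<; tri≈; tri>)
open import Relation.Binary.Consequences using (tri⇒dec<)
open import Relation.Binary.Structures using (IsStrictTotalOrder)
open import Relation.Nullary using (Dec; yes; no; ¬_; contradiction)
open import Relation.Nullary.Decidable using (_×-dec_)
open import Function.Base using (_∘_)
open import Function.Definitions using (Injective)

-- Label each vertex (x , B) of an independent set S by the point x if S
-- contains some (y , B) with x < y, and by the block B otherwise.  The
-- labelling is injective: two vertices labelled B are both the <-largest
-- vertex of S in block B, and two vertices (x , B₁), (x , B₂) labelled x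
-- with B₁ ≠ B₂ are impossible, since (x , B₂) is adjacent to the witness
-- (y , B₁).

lookup-injective : ∀ {A : Set} {xs : List A} → Unique xs → Injective _≡_ _≡_ (lookup xs)
lookup-injective {xs = _ ∷ _} _        {zero}  {zero}  _  = refl
lookup-injective {xs = _ ∷ _} (x∉ ∷ _) {zero}  {suc j} eq = contradiction eq (All.lookup x∉ (∈-lookup j))
lookup-injective {xs = _ ∷ _} (x∉ ∷ _) {suc i} {zero}  eq = contradiction (sym eq) (All.lookup x∉ (∈-lookup i))
lookup-injective {xs = _ ∷ _} (_ ∷ u)  {suc i} {suc j} eq = cong suc (lookup-injective u eq)

InjectiveOn : ∀ {A C : Set} → List A → (A → C) → Set
InjectiveOn xs f = ∀ {u v} → u ∈ xs → v ∈ xs → f u ≡ f v → u ≡ v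

length≤-injectiveOn : ∀ {A : Set} {k : ℕ} {xs : List A} (f : A → Fin k) →
                      Unique xs → InjectiveOn xs f → length xs ≤ k
length≤-injectiveOn f unique f-inj =
  injective⇒≤ λ {i} {j} eq → lookup-injective unique (f-inj (∈-lookup i) (∈-lookup j) eq)

join-injective : ∀ m n → Injective _≡_ _≡_ (join m n)
join-injective m n {u} {v} eq = begin
  u                      ≡⟨ sym (splitAt-join m n u) ⟩
  splitAt m (join m n u) ≡⟨ cong (splitAt m) eq ⟩
  splitAt m (join m n v) ≡⟨ splitAt-join m n v ⟩
  v                      ∎
  where open ≡-Reasoning

module IndependentSetBound {n b : ℕ} {_<_ : Fin n → Fin n → Set}
         (compare : Trichotomous _≡_ _<_) (B : Fin b → Subset n)
         {S : List (Fin n × Fin b)} (independent : IsIndependent _<_ B S) where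
  open IsIndependent independent

  LaterInBlock : Fin n × Fin b → Set
  LaterInBlock (x , i) = Any (λ { (y , j) → j ≡ i × x < y }) S

  laterInBlock? : ∀ u → Dec (LaterInBlock u)
  laterInBlock? (x , i) = any? (λ { (y , j) → (j ≟ i) ×-dec tri⇒dec< compare x y }) S

  label : Fin n × Fin b → Fin n ⊎ Fin b
  label (x , i) with laterInBlock? (x , i)
  ... | yes _ = inj₁ x
  ... | no  _ = inj₂ i

  lastInBlock-unique : ∀ {x y i} → (x , i) ∈ S → (y , i) ∈ S →
                       ¬ LaterInBlock (x , i) → ¬ LaterInBlock (y , i) → x ≡ y
  lastInBlock-unique {x} {y} xS yS x-last y-last with compare x y
  ... | tri< x<y _ _ = contradiction (lose yS (refl , x<y)) x-last
  ... | tri≈ _ x≡y _ = x≡y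
  ... | tri> _ _ y<x = contradiction (lose xS (refl , y<x)) y-last

  laterInBlock⇒block-unique : ∀ {x i j} → (x , i) ∈ S → (x , j) ∈ S →
                              LaterInBlock (x , i) → i ≡ j
  laterInBlock⇒block-unique {x} {i} {j} xiS xjS later with i ≟ j | find later
  ... | yes i≡j | _ = i≡j
  ... | no  i≢j | (z , .i) , zS , refl , x<z =
    contradiction (inj₁ (x<z , i≢j ∘ sym , vertices xiS)) (noEdges xjS zS)

  label-injectiveOn : InjectiveOn S label
  label-injectiveOn {x , i} {y , j} uS vS eq
    with laterInBlock? (x , i) | laterInBlock? (y , j) | eq
  ... | yes later  | yes _      | refl = cong (x ,_) (laterInBlock⇒block-unique uS vS later)
  ... | no  x-last | no  y-last | refl = cong (_, i) (lastInBlock-unique uS vS x-last y-last)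

  length≤ : length S ≤ n + b
  length≤ = length≤-injectiveOn (join n b ∘ label) unique
    (λ uS vS eq → label-injectiveOn uS vS (join-injective n b eq))

theorem2p4 : (m : ℕ) → 3 ≤ m →
             (n : ℕ) (_<_ : Fin n → Fin n → Set) → IsStrictTotalOrder _≡_ _<_ →
             (b : ℕ) (B : Fin b → Subset n) → Injective _≡_ _≡_ B →
             WeaklyBalanced (m ∸ 1) n b B →
             (S : List (Fin n × Fin b)) → IsIndependent _<_ B S →
             length S ≤ n + b
theorem2p4 _ _ _ _ strictTotal _ B _ _ _ independent =
  IndependentSetBound.length≤ (IsStrictTotalOrder.compare strictTotal) B independent
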